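{- For $n\geqslant 3$, the polynomial $\widehat{B}_{n}(x)$ is palindromic (i.e. $\widehat B(n,k)=\widehat B(n,n-k)$ for all $k$) and unimodal.
   Context: Let $\mathcal{S}^B_n$ be the set of signed permutations $\sigma$ of $\{\pm1,\dots,\pm n\}$ with $\sigma(-i)=-\sigma(i)$, written as $\sigma(0)\sigma(1)\cdots\sigma(n)$ with $\sigma(0)=0$. A position $j\in\{0,\dots,n-1\}$ is an alternating descent of $\sigma$ if $j$ is even and $\sigma(j)<\sigma(j+1)$, or $j$ is odd and $\sigma(j)>\sigma(j+1)$; ${\rm altdes}_B(\sigma)$ is their number. $\widehat{B}(n,k)=\#\{\sigma\in\mathcal{S}^B_n:{\rm altdes}_B(\sigma)=k\}$ and $\widehat{B}_n(x)=\sum_{k=0}^n\widehat{B}(n,k)x^k$. A sequence $a_0,\dots,a_n$ is unimodal if $a_0\leqslant\cdots\leqslant a_m\geqslant\cdots\geqslant a_n$ for some $m$. -}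

module Defs where

open import Data.Bool using (if_then_else_)
open import Data.Nat using (ℕ; zero; suc; _+_; _≤_; _<_; _∸_; _≟_)
open import Data.Nat.Properties using () renaming (_≟_ to _≟ℕ_)
open import Data.Integer as ℤ using (ℤ; +_; -_; ∣_∣) renaming (_<?_ to _<ℤ?_)
open import Data.Integer.Properties using () renaming (_≟_ to _≟ℤ_)
open import Data.List using (List; []; _∷_; map; concatMap; length; filter; _++_; upTo)
open import Data.List.Relation.Unary.Unique.Propositional using (Unique)
open import Data.List.Relation.Unary.Unique.DecPropositional _≟ℕ_ using (unique?)
open import Data.Product using (Σ; _×_; _,_)
open import Relation.Nullary using (Dec; yes; no; does)
open import Relation.Nullary.Decidable using (_×-dec_)
open import Relation.Binary.PropositionalEquality using (_≡_)

posVals : ℕ → List ℤ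
posVals n = map (λ i → + suc i) (upTo n)

vals : ℕ → List ℤ
vals n = map -_ (posVals n) ++ posVals n

words : ∀ {a} {A : Set a} → ℕ → List A → List (List A)
words zero    xs = [] ∷ []
words (suc n) xs = concatMap (λ x → map (x ∷_) (words n xs)) xs

-- A word σ(1)…σ(n) with entries in {±1,…,±n} is (the window of) a signed
-- permutation iff the absolute values |σ(1)|,…,|σ(n)| are pairwise distinct.
IsSignedPerm : List ℤ → Set
IsSignedPerm w = Unique (map ∣_∣ w)

isSignedPerm? : (w : List ℤ) → Dec (IsSignedPerm w)
isSignedPerm? w = unique? (map ∣_∣ w)

signedPerms : ℕ → List (List ℤ)
signedPerms n = filter isSignedPerm? (words n (vals n))

-- altdes of the sequence  prev = σ(j), rest = σ(j+1)…σ(n), with j's parity given.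
-- Position j is an alternating descent iff (j even and σ(j) < σ(j+1))
-- or (j odd and σ(j) > σ(j+1)).
data Parity : Set where
  even odd : Parity

flip : Parity → Parity
flip even = odd
flip odd  = even

altdesFrom : Parity → ℤ → List ℤ → ℕ
altdesFrom p    prev []       = 0
altdesFrom even prev (x ∷ xs) =
  (if does (prev ℤ.<? x) then 1 else 0) + altdesFrom odd x xs
altdesFrom odd  prev (x ∷ xs) =
  (if does (x ℤ.<? prev) then 1 else 0) + altdesFrom even x xs

-- altdes_B σ, with σ(0) = 0 prepended (position 0 is even).
altdesB : List ℤ → ℕ
altdesB w = altdesFrom even (+ 0) w

Bhat : ℕ → ℕ → ℕ
Bhat n k = length (filter (λ w → altdesB w ≟ℕ k) (signedPerms n))

Unimodal : (ℕ → ℕ) → ℕ → Set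
Unimodal a n = Σ ℕ λ m → m ≤ n
  × (∀ i → suc i ≤ m → a i ≤ a (suc i))
  × (∀ i → m ≤ i → suc i ≤ n → a (suc i) ≤ a i)

-- Negating every entry of σ turns each alternating descent into a non-descent and back, so
-- altdes_B(−σ) = n − altdes_B(σ) and B̂_n is palindromic.
--
-- Every signed permutation of [n+1] arises exactly once from one of [n] by inserting ±(n+1) at
-- some position and negating the entries after it.  Only the descents next to the new entry
-- change, which gives the recurrence
--   B̂(n+1,m) = (m+1) B̂(n,m+1) + (n+1−m) B̂(n,m) + m B̂(n,m−1) + (n+2−m) B̂(n,m−2).
--
-- Unimodality then follows by induction on n ≥ 3: the recurrence keeps a palindromic row weakly
-- increasing up to its centre.  The step from an odd row n = 2m+1 needs in addition
-- B̂(n,m) + (m+3) B̂(n,m−2) ≤ (m+4) B̂(n,m−1), which every odd row inherits from the even row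
-- before it.

module Submission where

open import Defs

open import Data.Bool using (if_then_else_)
open import Data.Empty using (⊥-elim)
open import Data.Integer as ℤ using (ℤ; +_; -_; -[1+_]; ∣_∣)
import Data.Integer.Properties as ℤ
open import Data.List using (List; []; _∷_; _++_; map; filter; length; concatMap)
import Data.List.Properties as List
open import Data.List.Membership.Propositional using (_∈_; find)
open import Data.List.Membership.Propositional.Properties
open import Data.List.Membership.Propositional.Properties.WithK using (unique∧set⇒bag)
open import Data.List.Relation.Binary.BagAndSetEquality using (∼bag⇒↭)
open import Data.List.Relation.Binary.Disjoint.Propositional using (Disjoint)
open import Data.List.Relation.Binary.Permutation.Propositional using (_↭_; ↭-sym)
import Data.List.Relation.Binary.Permutation.Propositional.Properties as ↭
open import Data.List.Relation.Unary.All as All using (All; []; _∷_)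
import Data.List.Relation.Unary.All.Properties as All
open import Data.List.Relation.Unary.AllPairs as AllPairs using (AllPairs; []; _∷_)
import Data.List.Relation.Unary.AllPairs.Properties as AllPairs
open import Data.List.Relation.Unary.Any as Any using (Any; here; there)
open import Data.List.Relation.Unary.Unique.Propositional using (Unique)
import Data.List.Relation.Unary.Unique.Propositional.Properties as Unique
open import Data.Nat using (ℕ; zero; suc; _+_; _*_; _∸_; _≤_; _<_; z≤n; s≤s; _≟_; _≤?_)
open import Data.Nat.ListAction using (sum)
import Data.Nat.ListAction.Properties as Sum
import Data.Nat.Properties as ℕ
open import Algebra.Properties.CommutativeSemigroup ℕ.+-commutativeSemigroup using ()
  renaming (interchange to +-interchange)
open import Data.Nat.Tactic.RingSolver using (solve-∀)
open import Data.Product using (_×_; _,_; proj₁; proj₂; ∃-syntax)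
open import Data.Sum using (inj₁; inj₂)
open import Function using (_∘_; _⇔_; mk⇔; Equivalence)
open import Relation.Binary.Definitions using (tri<; tri≈; tri>)
open import Relation.Binary.PropositionalEquality
open import Relation.Nullary using (Dec; yes; no; does; ¬_)
open import Relation.Nullary.Decidable using (dec-true; dec-false; toWitness)

-- Counting occurrences

δ : ℕ → ℕ → ℕ
δ zero    zero    = 1
δ zero    (suc _) = 0
δ (suc _) zero    = 0
δ (suc m) (suc k) = δ m k

δ-refl : ∀ m → δ m m ≡ 1
δ-refl zero    = refl
δ-refl (suc m) = δ-refl m

δ-≢ : ∀ {m k} → m ≢ k → δ m k ≡ 0
δ-≢ {zero}  {zero}  m≢k = ⊥-elim (m≢k refl)
δ-≢ {zero}  {suc k} _   = refl
δ-≢ {suc m} {zero}  _   = refl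
δ-≢ {suc m} {suc k} m≢k = δ-≢ (m≢k ∘ cong suc)

δ-cong : ∀ {m k m′ k′} → (m ≡ k → m′ ≡ k′) → (m′ ≡ k′ → m ≡ k) →
  δ m k ≡ δ m′ k′
δ-cong {m} {k} {m′} {k′} to from with m ≟ k
... | yes refl = trans (δ-refl m) (sym (subst (λ x → δ m′ x ≡ 1) (to refl) (δ-refl m′)))
... | no m≢k   = trans (δ-≢ m≢k) (sym (δ-≢ (m≢k ∘ from)))

δ-scale : ∀ m k {c d} → (m ≡ k → c ≡ d) → c * δ m k ≡ d * δ m k
δ-scale m k {c} {d} c≡d with m ≟ k
... | yes m≡k = cong (_* δ m k) (c≡d m≡k)
... | no m≢k  rewrite δ-≢ m≢k | ℕ.*-zeroʳ c | ℕ.*-zeroʳ d = refl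

occurrences : ℕ → List ℕ → ℕ
occurrences k xs = sum (map (δ k) xs)

occurrences-↭ : ∀ k {xs ys} → xs ↭ ys → occurrences k xs ≡ occurrences k ys
occurrences-↭ k p = Sum.sum-↭ (↭.map⁺ (δ k) p)

length-filter-≟ : ∀ {A : Set} (f : A → ℕ) k xs →
  length (filter (λ x → f x ≟ k) xs) ≡ occurrences k (map f xs)
length-filter-≟ f k []       = refl
length-filter-≟ f k (x ∷ xs) with f x ≟ k
... | yes fx≡k = begin
  length (filter (λ x → f x ≟ k) (x ∷ xs))
    ≡⟨ cong length (List.filter-accept (λ x → f x ≟ k) fx≡k) ⟩
  1 + length (filter (λ x → f x ≟ k) xs)
    ≡⟨ cong₂ _+_ (sym (trans (cong (δ k) fx≡k) (δ-refl k))) (length-filter-≟ f k xs) ⟩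
  δ k (f x) + occurrences k (map f xs) ∎
  where open ≡-Reasoning
... | no fx≢k = begin
  length (filter (λ x → f x ≟ k) (x ∷ xs))
    ≡⟨ cong length (List.filter-reject (λ x → f x ≟ k) fx≢k) ⟩
  0 + length (filter (λ x → f x ≟ k) xs)
    ≡⟨ cong₂ _+_ (sym (δ-≢ (fx≢k ∘ sym))) (length-filter-≟ f k xs) ⟩
  δ k (f x) + occurrences k (map f xs) ∎
  where open ≡-Reasoning

Bhat-occurrences : ∀ n k → Bhat n k ≡ occurrences k (map altdesB (signedPerms n))
Bhat-occurrences n k = length-filter-≟ altdesB k (signedPerms n)

-- Alternating descents

indicator : ∀ {P : Set} → Dec P → ℕ
indicator P? = if does P? then 1 else 0

indicator-yes : ∀ {P : Set} (P? : Dec P) → P → indicator P? ≡ 1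
indicator-yes P? p rewrite dec-true P? p = refl

indicator-no : ∀ {P : Set} (P? : Dec P) → ¬ P → indicator P? ≡ 0
indicator-no P? ¬p rewrite dec-false P? ¬p = refl

indicator-≤1 : ∀ {P : Set} (P? : Dec P) → indicator P? ≤ 1
indicator-≤1 (yes _) = s≤s z≤n
indicator-≤1 (no _)  = z≤n

indicator-cong : ∀ {P Q : Set} (P? : Dec P) (Q? : Dec Q) → P ⇔ Q → indicator P? ≡ indicator Q?
indicator-cong (yes p) Q? P⇔Q = sym (indicator-yes Q? (Equivalence.to P⇔Q p))
indicator-cong (no ¬p) Q? P⇔Q = sym (indicator-no Q? (¬p ∘ Equivalence.from P⇔Q))

Descent : Parity → ℤ → ℤ → Set
Descent even a b = a ℤ.< b
Descent odd  a b = b ℤ.< a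

descent? : ∀ p a b → Dec (Descent p a b)
descent? even a b = a ℤ.<? b
descent? odd  a b = b ℤ.<? a

localDescent : Parity → ℤ → ℤ → ℕ
localDescent p a b = indicator (descent? p a b)

altdesFrom-∷ : ∀ p a x xs → altdesFrom p a (x ∷ xs) ≡ localDescent p a x + altdesFrom (flip p) x xs
altdesFrom-∷ even a x xs = refl
altdesFrom-∷ odd  a x xs = refl

altdesFrom-≤-length : ∀ p a xs → altdesFrom p a xs ≤ length xs
altdesFrom-≤-length p a []       = z≤n
altdesFrom-≤-length p a (x ∷ xs) rewrite altdesFrom-∷ p a x xs =
  ℕ.+-mono-≤ (indicator-≤1 (descent? p a x)) (altdesFrom-≤-length (flip p) x xs)

Descent-neg : ∀ p a b → Descent p (- a) (- b) ⇔ Descent (flip p) a b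
Descent-neg even a b = mk⇔ ℤ.neg-cancel-< ℤ.neg-mono-<
Descent-neg odd  a b = mk⇔ ℤ.neg-cancel-< ℤ.neg-mono-<

localDescent-neg : ∀ p a b → localDescent p (- a) (- b) ≡ localDescent (flip p) a b
localDescent-neg p a b = indicator-cong (descent? p (- a) (- b)) (descent? (flip p) a b) (Descent-neg p a b)

altdesFrom-neg : ∀ p a xs → altdesFrom p (- a) (map -_ xs) ≡ altdesFrom (flip p) a xs
altdesFrom-neg p a []       = refl
altdesFrom-neg p a (x ∷ xs) = begin
  altdesFrom p (- a) (- x ∷ map -_ xs)
    ≡⟨ altdesFrom-∷ p (- a) (- x) (map -_ xs) ⟩
  localDescent p (- a) (- x) + altdesFrom (flip p) (- x) (map -_ xs)
    ≡⟨ cong₂ _+_ (localDescent-neg p a x) (altdesFrom-neg (flip p) x xs) ⟩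
  localDescent (flip p) a x + altdesFrom (flip (flip p)) x xs
    ≡⟨ sym (altdesFrom-∷ (flip p) a x xs) ⟩
  altdesFrom (flip p) a (x ∷ xs) ∎
  where open ≡-Reasoning

localDescent-complement : ∀ p {a b} → a ≢ b → localDescent p a b + localDescent (flip p) a b ≡ 1
localDescent-complement even {a} {b} a≢b with ℤ.<-cmp a b
... | tri< a<b _ _ rewrite indicator-yes (a ℤ.<? b) a<b | indicator-no (b ℤ.<? a) (ℤ.<-asym a<b) = refl
... | tri≈ _ a≡b _ = ⊥-elim (a≢b a≡b)
... | tri> _ _ b<a rewrite indicator-no (a ℤ.<? b) (ℤ.<-asym b<a) | indicator-yes (b ℤ.<? a) b<a = refl
localDescent-complement odd {a} {b} a≢b =
  trans (ℕ.+-comm (localDescent odd a b) _) (localDescent-complement even a≢b)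

altdesFrom-complement : ∀ p a xs → Unique (a ∷ xs) →
  altdesFrom p a xs + altdesFrom (flip p) a xs ≡ length xs
altdesFrom-complement p a []       _                  = refl
altdesFrom-complement p a (x ∷ xs) ((a≢x ∷ _) ∷ uniq) = begin
  altdesFrom p a (x ∷ xs) + altdesFrom (flip p) a (x ∷ xs)
    ≡⟨ cong₂ _+_ (altdesFrom-∷ p a x xs) (altdesFrom-∷ (flip p) a x xs) ⟩
  (d + A) + (d′ + A′)
    ≡⟨ +-interchange d A d′ A′ ⟩
  (d + d′) + (A + A′)
    ≡⟨ cong₂ _+_ (localDescent-complement p a≢x) (altdesFrom-complement (flip p) x xs uniq) ⟩
  suc (length xs) ∎
  where
  open ≡-Reasoning
  d d′ A A′ : ℕ
  d  = localDescent p a x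
  d′ = localDescent (flip p) a x
  A  = altdesFrom (flip p) x xs
  A′ = altdesFrom (flip (flip p)) x xs

-- Signed permutations

InRange : ℕ → ℕ → Set
InRange n a = 0 < a × a ≤ n

SignedPerm : ℕ → List ℤ → Set
SignedPerm n w = length w ≡ n × All (InRange n) (map ∣_∣ w) × Unique (map ∣_∣ w)

∈-vals⁻ : ∀ n {x} → x ∈ vals n → InRange n ∣ x ∣
∈-vals⁻ n x∈ with ∈-++⁻ (map -_ (posVals n)) x∈
... | inj₁ x∈neg with ∈-map⁻ -_ x∈neg
...   | _ , y∈ , refl with ∈-map⁻ (λ i → + suc i) y∈
...     | _ , i∈ , refl = s≤s z≤n , ∈-upTo⁻ i∈
∈-vals⁻ n x∈ | inj₂ x∈pos with ∈-map⁻ (λ i → + suc i) x∈pos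
... | _ , i∈ , refl = s≤s z≤n , ∈-upTo⁻ i∈

∈-vals⁺ : ∀ n {x} → InRange n ∣ x ∣ → x ∈ vals n
∈-vals⁺ n {+ suc i}    (_ , i<n) = ∈-++⁺ʳ (map -_ (posVals n)) (∈-map⁺ (λ i → + suc i) (∈-upTo⁺ i<n))
∈-vals⁺ n { -[1+ i ] } (_ , i<n) = ∈-++⁺ˡ (∈-map⁺ -_ (∈-map⁺ (λ i → + suc i) (∈-upTo⁺ i<n)))

∈-words⁻ : ∀ {A : Set} n (xs : List A) {w} → w ∈ words n xs → length w ≡ n × All (_∈ xs) w
∈-words⁻ zero    xs (here refl) = refl , []
∈-words⁻ (suc n) xs w∈ with find (∈-concatMap⁻ (λ x → map (x ∷_) (words n xs)) {xs = xs} w∈)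
... | x , x∈ , w∈x∷ with ∈-map⁻ (x ∷_) w∈x∷
...   | v , v∈ , refl with ∈-words⁻ n xs v∈
...     | len , all = cong suc len , x∈ ∷ all

∈-words⁺ : ∀ {A : Set} n (xs : List A) {w} → length w ≡ n → All (_∈ xs) w → w ∈ words n xs
∈-words⁺ zero    xs {[]}    refl []          = here refl
∈-words⁺ (suc n) xs {x ∷ w} len  (x∈ ∷ all) =
  ∈-concatMap⁺ (λ y → map (y ∷_) (words n xs)) {xs = xs}
    (Any.map (λ { refl → ∈-map⁺ (x ∷_) (∈-words⁺ n xs (ℕ.suc-injective len) all) }) x∈)

∈-signedPerms⁻ : ∀ n {w} → w ∈ signedPerms n → SignedPerm n w
∈-signedPerms⁻ n w∈ with ∈-filter⁻ isSignedPerm? {xs = words n (vals n)} w∈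
... | w∈words , uniq with ∈-words⁻ n (vals n) w∈words
...   | len , all = len , All.map⁺ (All.map (∈-vals⁻ n) all) , uniq

∈-signedPerms⁺ : ∀ n {w} → SignedPerm n w → w ∈ signedPerms n
∈-signedPerms⁺ n (len , ranges , uniq) = ∈-filter⁺ isSignedPerm? {xs = words n (vals n)}
  (∈-words⁺ n (vals n) len (All.map (∈-vals⁺ n) (All.map⁻ ranges))) uniq

words-unique : ∀ {A : Set} n {xs : List A} → Unique xs → Unique (words n xs)
words-unique zero    _    = [] ∷ []
words-unique (suc n) {xs} uniq = Unique.concat⁺
  (All.map⁺ (All.tabulate λ _ → Unique.map⁺ List.∷-injectiveʳ (words-unique n uniq)))
  (AllPairs.map⁺ (AllPairs.map disjoint uniq))
  where
  disjoint : ∀ {x y} → x ≢ y → Disjoint (map (x ∷_) (words n xs)) (map (y ∷_) (words n xs))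
  disjoint x≢y (v∈x , v∈y) with ∈-map⁻ _ v∈x | ∈-map⁻ _ v∈y
  ... | _ , _ , refl | _ , _ , eq = x≢y (List.∷-injectiveˡ eq)

vals-unique : ∀ n → Unique (vals n)
vals-unique n = Unique.++⁺ (Unique.map⁺ ℤ.neg-injective positive-unique) positive-unique disjoint
  where
  positive-unique : Unique (posVals n)
  positive-unique = Unique.map⁺ (λ { refl → refl }) (Unique.upTo⁺ n)
  disjoint : Disjoint (map -_ (posVals n)) (posVals n)
  disjoint (x∈neg , x∈pos) with ∈-map⁻ -_ x∈neg
  ... | _ , y∈ , refl with ∈-map⁻ (λ i → + suc i) y∈ | ∈-map⁻ (λ i → + suc i) x∈pos
  ...   | _ , _ , refl | _ , _ , ()

signedPerms-unique : ∀ n → Unique (signedPerms n)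
signedPerms-unique n = Unique.filter⁺ isSignedPerm? (words-unique n (vals-unique n))

-- Negation and palindromicity

map-neg-involutive : ∀ σ → map -_ (map -_ σ) ≡ σ
map-neg-involutive []      = refl
map-neg-involutive (x ∷ σ) = cong₂ _∷_ (ℤ.neg-involutive x) (map-neg-involutive σ)

map-∣∣-neg : ∀ σ → map ∣_∣ (map -_ σ) ≡ map ∣_∣ σ
map-∣∣-neg []      = refl
map-∣∣-neg (x ∷ σ) = cong₂ _∷_ (ℤ.∣-i∣≡∣i∣ x) (map-∣∣-neg σ)

SignedPerm-neg : ∀ {n σ} → SignedPerm n σ → SignedPerm n (map -_ σ)
SignedPerm-neg {n} {σ} (len , ranges , uniq) =
  trans (List.length-map -_ σ) len ,
  subst (All (InRange n)) (sym (map-∣∣-neg σ)) ranges ,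
  subst Unique (sym (map-∣∣-neg σ)) uniq

altdesB-≤ : ∀ {n σ} → SignedPerm n σ → altdesB σ ≤ n
altdesB-≤ {σ = σ} (len , _) = subst (altdesB σ ≤_) len (altdesFrom-≤-length even (+ 0) σ)

altdesB-neg : ∀ {n σ} → SignedPerm n σ → altdesB (map -_ σ) ≡ n ∸ altdesB σ
altdesB-neg {n} {σ} (len , ranges , uniq) = begin
  altdesB (map -_ σ)                         ≡⟨ sym (ℕ.m+n∸m≡n (altdesB σ) _) ⟩
  altdesB σ + altdesB (map -_ σ) ∸ altdesB σ ≡⟨ cong (_∸ altdesB σ) complement ⟩
  n ∸ altdesB σ                              ∎
  where
  open ≡-Reasoning
  0∷σ-unique : Unique (+ 0 ∷ σ)
  0∷σ-unique = Unique.map⁻ (All.map (λ { (0<a , _) a≡0 → ℕ.<-irrefl a≡0 0<a }) ranges ∷ uniq)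
  complement : altdesB σ + altdesB (map -_ σ) ≡ n
  complement = begin
    altdesB σ + altdesB (map -_ σ)              ≡⟨ cong (_+_ (altdesB σ)) (altdesFrom-neg even (+ 0) σ) ⟩
    altdesB σ + altdesFrom odd (+ 0) σ          ≡⟨ altdesFrom-complement even (+ 0) σ 0∷σ-unique ⟩
    length σ                                    ≡⟨ len ⟩
    n                                           ∎

signedPerms-neg-↭ : ∀ n → map (map -_) (signedPerms n) ↭ signedPerms n
signedPerms-neg-↭ n = ∼bag⇒↭ (unique∧set⇒bag negated-unique (signedPerms-unique n) (mk⇔ to from))
  where
  negated-unique : Unique (map (map -_) (signedPerms n))
  negated-unique = Unique.map⁺ (λ {σ} {τ} eq → trans (sym (map-neg-involutive σ))
    (trans (cong (map -_) eq) (map-neg-involutive τ))) (signedPerms-unique n)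
  to : ∀ {w} → w ∈ map (map -_) (signedPerms n) → w ∈ signedPerms n
  to w∈ with ∈-map⁻ (map -_) w∈
  ... | σ , σ∈ , refl = ∈-signedPerms⁺ n (SignedPerm-neg (∈-signedPerms⁻ n σ∈))
  from : ∀ {w} → w ∈ signedPerms n → w ∈ map (map -_) (signedPerms n)
  from {w} w∈ = subst (_∈ map (map -_) (signedPerms n)) (map-neg-involutive w)
    (∈-map⁺ (map -_) (∈-signedPerms⁺ n (SignedPerm-neg (∈-signedPerms⁻ n w∈))))

occurrences-∸ : ∀ {n k} xs → k ≤ n → All (_≤ n) xs →
  occurrences k (map (n ∸_) xs) ≡ occurrences (n ∸ k) xs
occurrences-∸         []       _   []          = refl
occurrences-∸ {n} {k} (x ∷ xs) k≤n (x≤n ∷ xs≤n) = cong₂ _+_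
  (δ-cong (λ k≡n∸x → trans (cong (n ∸_) k≡n∸x) (ℕ.m∸[m∸n]≡n x≤n))
          (λ n∸k≡x → trans (sym (ℕ.m∸[m∸n]≡n k≤n)) (cong (n ∸_) n∸k≡x)))
  (occurrences-∸ xs k≤n xs≤n)

Bhat-palindromic : ∀ n k → k ≤ n → Bhat n k ≡ Bhat n (n ∸ k)
Bhat-palindromic n k k≤n = begin
  Bhat n k
    ≡⟨ Bhat-occurrences n k ⟩
  occurrences k (map altdesB SP)
    ≡⟨ occurrences-↭ k (↭.map⁺ altdesB (↭-sym (signedPerms-neg-↭ n))) ⟩
  occurrences k (map altdesB (map (map -_) SP))
    ≡⟨ cong (occurrences k) (sym (List.map-∘ SP)) ⟩
  occurrences k (map (altdesB ∘ map -_) SP)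
    ≡⟨ cong (occurrences k) (List.map-cong-local (All.tabulate (altdesB-neg ∘ ∈-signedPerms⁻ n))) ⟩
  occurrences k (map ((n ∸_) ∘ altdesB) SP)
    ≡⟨ cong (occurrences k) (List.map-∘ SP) ⟩
  occurrences k (map (n ∸_) (map altdesB SP))
    ≡⟨ occurrences-∸ (map altdesB SP) k≤n (All.map⁺ (All.tabulate (altdesB-≤ ∘ ∈-signedPerms⁻ n))) ⟩
  occurrences (n ∸ k) (map altdesB SP)
    ≡⟨ sym (Bhat-occurrences n (n ∸ k)) ⟩
  Bhat n (n ∸ k) ∎
  where
  open ≡-Reasoning
  SP : List (List ℤ)
  SP = signedPerms n

-- Inserting ±(n + 1)

-- Negating the suffix after ±X undoes the parity shift of its positions (altdesFrom-neg).
insertions : ℤ → List ℤ → List (List ℤ)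
insertions X []      = (X ∷ []) ∷ (- X ∷ []) ∷ []
insertions X (y ∷ σ) = (X ∷ map -_ (y ∷ σ)) ∷ (- X ∷ map -_ (y ∷ σ)) ∷ map (y ∷_) (insertions X σ)

removeAbs : ℕ → List ℤ → List ℤ
removeAbs N []       = []
removeAbs N (x ∷ xs) with ∣ x ∣ ≟ N
... | yes _ = map -_ xs
... | no  _ = x ∷ removeAbs N xs

removeAbs-All : ∀ {P : ℕ → Set} N w → All P (map ∣_∣ w) → All P (map ∣_∣ (removeAbs N w))
removeAbs-All N []       []         = []
removeAbs-All {P} N (x ∷ xs) (px ∷ pxs) with ∣ x ∣ ≟ N
... | yes _ = subst (All P) (sym (map-∣∣-neg xs)) pxs
... | no  _ = px ∷ removeAbs-All N xs pxs

removeAbs-unique : ∀ N w → Unique (map ∣_∣ w) → Unique (map ∣_∣ (removeAbs N w))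
removeAbs-unique N []       uniq            = uniq
removeAbs-unique N (x ∷ xs) (x∉xs ∷ uniq) with ∣ x ∣ ≟ N
... | yes _ = subst Unique (sym (map-∣∣-neg xs)) uniq
... | no  _ = removeAbs-All N xs x∉xs ∷ removeAbs-unique N xs uniq

InRange-pred : ∀ {n a} → InRange (suc n) a → a ≢ suc n → InRange n a
InRange-pred (0<a , a≤1+n) a≢1+n = 0<a , ℕ.≤-pred (ℕ.≤∧≢⇒< a≤1+n a≢1+n)

removeAbs-InRange : ∀ n w → Unique (map ∣_∣ w) → All (InRange (suc n)) (map ∣_∣ w) →
  All (InRange n) (map ∣_∣ (removeAbs (suc n) w))
removeAbs-InRange n []       _             []             = []
removeAbs-InRange n (x ∷ xs) (x∉xs ∷ uniq) (x∈ ∷ xs∈) with ∣ x ∣ ≟ suc n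
... | yes x≡N = subst (All (InRange n)) (sym (map-∣∣-neg xs))
  (All.zipWith (λ (y∈ , x≢y) → InRange-pred y∈ (λ y≡N → x≢y (trans x≡N (sym y≡N)))) (xs∈ , x∉xs))
... | no  x≢N  = InRange-pred x∈ x≢N ∷ removeAbs-InRange n xs uniq xs∈

length-removeAbs-≤ : ∀ N w → length w ≤ suc (length (removeAbs N w))
length-removeAbs-≤ N []       = z≤n
length-removeAbs-≤ N (x ∷ xs) with ∣ x ∣ ≟ N
... | yes _ = s≤s (ℕ.≤-reflexive (sym (List.length-map -_ xs)))
... | no  _ = s≤s (length-removeAbs-≤ N xs)

length-removeAbs : ∀ N w → Any (λ x → ∣ x ∣ ≡ N) w → suc (length (removeAbs N w)) ≡ length w
length-removeAbs N (x ∷ xs) N∈ with ∣ x ∣ ≟ N | N∈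
... | yes _   | _           = cong suc (List.length-map -_ xs)
... | no  x≢N | here x≡N    = ⊥-elim (x≢N x≡N)
... | no  _   | there N∈xs  = cong suc (length-removeAbs N xs N∈xs)

length-≤-range : ∀ m w → Unique (map ∣_∣ w) → All (InRange m) (map ∣_∣ w) → length w ≤ m
length-≤-range zero    []      _    _                  = z≤n
length-≤-range zero    (_ ∷ _) _    ((0<a , a≤0) ∷ _) = ⊥-elim (ℕ.<-irrefl refl (ℕ.<-≤-trans 0<a a≤0))
length-≤-range (suc m) w       uniq ranges           = ℕ.≤-trans (length-removeAbs-≤ (suc m) w)
  (s≤s (length-≤-range m (removeAbs (suc m) w) (removeAbs-unique (suc m) w uniq)
                                               (removeAbs-InRange m w uniq ranges)))

SignedPerm-∋-max : ∀ n {w} → SignedPerm (suc n) w → Any (λ x → ∣ x ∣ ≡ suc n) w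
SignedPerm-∋-max n {w} (len , ranges , uniq) with Any.any? (λ x → ∣ x ∣ ≟ suc n) w
... | yes N∈ = N∈
... | no  N∉ = ⊥-elim (ℕ.<-irrefl refl (subst (_≤ n) len (length-≤-range n w uniq ranges′)))
  where
  ranges′ : All (InRange n) (map ∣_∣ w)
  ranges′ = All.zipWith (λ (a∈ , a≢N) → InRange-pred a∈ a≢N)
                        (ranges , All.map⁺ (All.¬Any⇒All¬ w N∉))

data Insertion (X : ℤ) : List ℤ → List ℤ → Set where
  top    : ∀ {σ} → Insertion X σ (X ∷ map -_ σ)
  bottom : ∀ {σ} → Insertion X σ (- X ∷ map -_ σ)
  skip   : ∀ {σ w} y → Insertion X σ w → Insertion X (y ∷ σ) (y ∷ w)

∈-insertions⁻ : ∀ X σ {w} → w ∈ insertions X σ → Insertion X σ w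
∈-insertions⁻ X []      (here refl)                = top
∈-insertions⁻ X []      (there (here refl))        = bottom
∈-insertions⁻ X (y ∷ σ) (here refl)                = top
∈-insertions⁻ X (y ∷ σ) (there (here refl))        = bottom
∈-insertions⁻ X (y ∷ σ) (there (there w∈)) with ∈-map⁻ (y ∷_) w∈
... | v , v∈ , refl = skip y (∈-insertions⁻ X σ v∈)

∈-insertions⁺ : ∀ {X σ w} → Insertion X σ w → w ∈ insertions X σ
∈-insertions⁺ {σ = []}    top          = here refl
∈-insertions⁺ {σ = []}    bottom       = there (here refl)
∈-insertions⁺ {σ = _ ∷ _} top          = here refl
∈-insertions⁺ {σ = _ ∷ _} bottom       = there (here refl)
∈-insertions⁺             (skip y ins) = there (there (∈-map⁺ (y ∷_) (∈-insertions⁺ ins)))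

Insertion-length : ∀ {X σ w} → Insertion X σ w → length w ≡ suc (length σ)
Insertion-length {σ = σ} top        = cong suc (List.length-map -_ σ)
Insertion-length {σ = σ} bottom     = cong suc (List.length-map -_ σ)
Insertion-length         (skip _ i) = cong suc (Insertion-length i)

Insertion-All : ∀ {P : ℕ → Set} {X σ w} → P ∣ X ∣ → All P (map ∣_∣ σ) → Insertion X σ w →
  All P (map ∣_∣ w)
Insertion-All {P} {σ = σ} pX pσ top    = pX ∷ subst (All P) (sym (map-∣∣-neg σ)) pσ
Insertion-All {P} {X} {σ} pX pσ bottom =
  subst P (sym (ℤ.∣-i∣≡∣i∣ X)) pX ∷ subst (All P) (sym (map-∣∣-neg σ)) pσ
Insertion-All pX (py ∷ pσ) (skip _ i)  = py ∷ Insertion-All pX pσ i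

Insertion-unique : ∀ {X σ w} → All (∣ X ∣ ≢_) (map ∣_∣ σ) → Unique (map ∣_∣ σ) →
  Insertion X σ w → Unique (map ∣_∣ w)
Insertion-unique {X} {σ} X∉σ uniq top    =
  subst (λ l → Unique (∣ X ∣ ∷ l)) (sym (map-∣∣-neg σ)) (X∉σ ∷ uniq)
Insertion-unique {X} {σ} X∉σ uniq bottom =
  subst₂ (λ a l → Unique (a ∷ l)) (sym (ℤ.∣-i∣≡∣i∣ X)) (sym (map-∣∣-neg σ)) (X∉σ ∷ uniq)
Insertion-unique {X} (X≢y ∷ X∉σ) (y∉σ ∷ uniq) (skip y i) =
  Insertion-All (λ X≡y → X≢y (sym X≡y)) y∉σ i ∷ Insertion-unique X∉σ uniq i

removeAbs-here : ∀ {N} x xs → ∣ x ∣ ≡ N → removeAbs N (x ∷ xs) ≡ map -_ xs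
removeAbs-here {N} x xs x≡N with ∣ x ∣ ≟ N
... | yes _   = refl
... | no  x≢N = ⊥-elim (x≢N x≡N)

removeAbs-there : ∀ {N} x xs → ∣ x ∣ ≢ N → removeAbs N (x ∷ xs) ≡ x ∷ removeAbs N xs
removeAbs-there {N} x xs x≢N with ∣ x ∣ ≟ N
... | yes x≡N = ⊥-elim (x≢N x≡N)
... | no  _   = refl

removeAbs-Insertion : ∀ {X σ w} → All (_≢ ∣ X ∣) (map ∣_∣ σ) → Insertion X σ w →
  removeAbs ∣ X ∣ w ≡ σ
removeAbs-Insertion {X} {σ} _ top    =
  trans (removeAbs-here X (map -_ σ) refl) (map-neg-involutive σ)
removeAbs-Insertion {X} {σ} _ bottom =
  trans (removeAbs-here (- X) (map -_ σ) (ℤ.∣-i∣≡∣i∣ X)) (map-neg-involutive σ)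
removeAbs-Insertion (y≢X ∷ σ≢X) (skip {w = w} y i) =
  trans (removeAbs-there y w y≢X) (cong (y ∷_) (removeAbs-Insertion σ≢X i))

Insertion-head : ∀ n {x} xs → ∣ x ∣ ≡ suc n → Insertion (+ suc n) (map -_ xs) (x ∷ xs)
Insertion-head n {+ _}      xs refl =
  subst (λ l → Insertion (+ suc n) (map -_ xs) (+ suc n ∷ l)) (map-neg-involutive xs) top
Insertion-head n { -[1+ _ ]} xs refl =
  subst (λ l → Insertion (+ suc n) (map -_ xs) (-[1+ n ] ∷ l)) (map-neg-involutive xs) bottom

Insertion-removeAbs : ∀ n w → Any (λ x → ∣ x ∣ ≡ suc n) w →
  Insertion (+ suc n) (removeAbs (suc n) w) w
Insertion-removeAbs n (x ∷ xs) N∈ with ∣ x ∣ ≟ suc n | N∈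
... | yes x≡N | _          = Insertion-head n xs x≡N
... | no  x≢N | here x≡N   = ⊥-elim (x≢N x≡N)
... | no  _   | there N∈xs = skip x (Insertion-removeAbs n xs N∈xs)

insertions-unique : ∀ n {σ} → All (_≢ suc n) (map ∣_∣ σ) → Unique (insertions (+ suc n) σ)
insertions-unique n {[]}    _             = ((λ ()) ∷ []) ∷ [] ∷ []
insertions-unique n {y ∷ σ} (y≢N ∷ σ≢N) =
  ((λ ()) ∷ heads-differ λ { refl → y≢N refl }) ∷ heads-differ (λ { refl → y≢N refl })
  ∷ Unique.map⁺ List.∷-injectiveʳ (insertions-unique n σ≢N)
  where
  heads-differ : ∀ {x v} → x ≢ y → All (x ∷ v ≢_) (map (y ∷_) (insertions (+ suc n) σ))
  heads-differ x≢y = All.map⁺ (All.universal (λ _ eq → x≢y (List.∷-injectiveˡ eq)) _)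

All⇒AllPairs : ∀ {A : Set} {P : A → Set} {xs} → All P xs → AllPairs (λ x y → P x × P y) xs
All⇒AllPairs []         = []
All⇒AllPairs (px ∷ pxs) = All.map (px ,_) pxs ∷ All⇒AllPairs pxs

InRange-≢-suc : ∀ {n a} → InRange n a → a ≢ suc n
InRange-≢-suc (_ , a≤n) refl = ℕ.<-irrefl refl a≤n

signedPerms-suc-↭ : ∀ n → signedPerms (suc n) ↭ concatMap (insertions (+ suc n)) (signedPerms n)
signedPerms-suc-↭ n =
  ∼bag⇒↭ (unique∧set⇒bag (signedPerms-unique (suc n)) insertions-all-unique (mk⇔ to from))
  where
  SP : List (List ℤ)
  SP = signedPerms n
  fresh : ∀ {σ} → SignedPerm n σ → All (_≢ suc n) (map ∣_∣ σ)
  fresh (_ , ranges , _) = All.map InRange-≢-suc ranges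
  all-fresh : All (λ σ → All (_≢ suc n) (map ∣_∣ σ)) SP
  all-fresh = All.tabulate (fresh ∘ ∈-signedPerms⁻ n)
  disjoint : ∀ {σ τ} → σ ≢ τ × All (_≢ suc n) (map ∣_∣ σ) × All (_≢ suc n) (map ∣_∣ τ) →
    Disjoint (insertions (+ suc n) σ) (insertions (+ suc n) τ)
  disjoint (σ≢τ , σ-fresh , τ-fresh) (w∈σ , w∈τ) = σ≢τ (trans
    (sym (removeAbs-Insertion σ-fresh (∈-insertions⁻ _ _ w∈σ)))
    (removeAbs-Insertion τ-fresh (∈-insertions⁻ _ _ w∈τ)))
  insertions-all-unique : Unique (concatMap (insertions (+ suc n)) SP)
  insertions-all-unique = Unique.concat⁺ (All.map⁺ (All.map (insertions-unique n) all-fresh))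
    (AllPairs.map⁺ (AllPairs.zipWith disjoint (signedPerms-unique n , All⇒AllPairs all-fresh)))
  to : ∀ {w} → w ∈ signedPerms (suc n) → w ∈ concatMap (insertions (+ suc n)) SP
  to {w} w∈ = ∈-concatMap⁺ (insertions (+ suc n)) {xs = SP}
    (Any.map (λ { refl → ∈-insertions⁺ (Insertion-removeAbs n w N∈w) }) (∈-signedPerms⁺ n perm))
    where
    w-perm : SignedPerm (suc n) w
    w-perm = ∈-signedPerms⁻ (suc n) w∈
    N∈w : Any (λ x → ∣ x ∣ ≡ suc n) w
    N∈w = SignedPerm-∋-max n w-perm
    perm : SignedPerm n (removeAbs (suc n) w)
    perm with w-perm
    ... | len , ranges , uniq = ℕ.suc-injective (trans (length-removeAbs (suc n) w N∈w) len)
                              , removeAbs-InRange n w uniq ranges , removeAbs-unique (suc n) w uniq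
  from : ∀ {w} → w ∈ concatMap (insertions (+ suc n)) SP → w ∈ signedPerms (suc n)
  from w∈ with find (∈-concatMap⁻ (insertions (+ suc n)) {xs = SP} w∈)
  ... | σ , σ∈ , w∈σ with ∈-signedPerms⁻ n σ∈ | ∈-insertions⁻ _ σ w∈σ
  ...   | perm@(len , ranges , uniq) | ins = ∈-signedPerms⁺ (suc n)
          ( trans (Insertion-length ins) (cong suc len)
          , Insertion-All (s≤s z≤n , ℕ.≤-refl)
                          (All.map (λ (0<a , a≤n) → 0<a , ℕ.m≤n⇒m≤1+n a≤n) ranges) ins
          , Insertion-unique (All.map (λ a≢N N≡a → a≢N (sym N≡a)) (fresh perm)) uniq ins)

-- The recurrence

-- Of the 2(L+1) insertions into a word of length L with A alternating descents,
-- A have A − 1 descents, L − A + 1 have A, A + 1 have A + 1 and L − A have A + 2.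
insertionCount : ℕ → ℕ → ℕ → ℕ
insertionCount A L m =
  A * δ (suc m) A + suc (L ∸ A) * δ m A + suc A * δ m (suc A) + (L ∸ A) * δ m (suc (suc A))

occurrences-suc : ∀ m xs → occurrences (suc m) (map suc xs) ≡ occurrences m xs
occurrences-suc m xs = cong sum (sym (List.map-∘ xs))

occurrences-zero-suc : ∀ xs → occurrences 0 (map suc xs) ≡ 0
occurrences-zero-suc []       = refl
occurrences-zero-suc (x ∷ xs) = occurrences-zero-suc xs

insertionCount-∷ : ∀ {s A L} m xs → s ≤ 1 → A ≤ L →
  (∀ j → occurrences j xs ≡ insertionCount A L j) →
  δ m A + δ m (2 + A) + occurrences m (map (_+_ s) xs) ≡ insertionCount (s + A) (suc L) m
insertionCount-∷ {A = A} {L} m xs z≤n A≤L count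
  rewrite ℕ.+-∸-assoc 1 A≤L =
  trans (cong (_+_ (δ m A + δ m (2 + A))) (trans (cong (occurrences m) (List.map-id xs)) (count m)))
        (identity A (δ (suc m) A) (δ m A) (δ m (suc A)) (δ m (suc (suc A))) (L ∸ A))
  where
  identity : ∀ A u w v z D → w + z + (A * u + suc D * w + suc A * v + D * z)
                             ≡ A * u + suc (suc D) * w + suc A * v + suc D * z
  identity = solve-∀
insertionCount-∷ {A = A} {L} (suc m) xs (s≤s z≤n) A≤L count =
  trans (cong (_+_ (δ (suc m) A + δ m (suc A))) (trans (occurrences-suc m xs) (count m)))
          (identity A (δ (suc m) A) (δ m A) (δ m (suc A)) (δ m (suc (suc A))) (L ∸ A))
  where
  identity : ∀ A u w v z D → u + v + (A * u + suc D * w + suc A * v + D * z)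
                             ≡ suc A * u + suc D * w + suc (suc A) * v + D * z
  identity = solve-∀
insertionCount-∷ {A = zero} {L} zero xs (s≤s z≤n) A≤L count =
  trans (cong (_+_ (1 + 0)) (occurrences-zero-suc xs)) (identity L)
  where
  identity : ∀ D → 1 + 0 + 0 ≡ 1 * 1 + suc D * 0 + 2 * 0 + D * 0
  identity = solve-∀
insertionCount-∷ {A = suc A} {L} zero xs (s≤s z≤n) A≤L count =
  trans (cong (_+_ (0 + 0)) (occurrences-zero-suc xs)) (identity A (L ∸ suc A))
  where
  identity : ∀ A D → 0 + 0 + 0 ≡ suc (suc A) * 0 + suc D * 0 + suc (suc (suc A)) * 0 + D * 0
  identity = solve-∀

∣i∣<n⇒i<+n : ∀ {n} a → ∣ a ∣ < n → a ℤ.< + n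
∣i∣<n⇒i<+n (+ _)    a<n = ℤ.+<+ a<n
∣i∣<n⇒i<+n -[1+ _ ] _   = ℤ.-<+

∣i∣<n⇒-n<i : ∀ {n} a → ∣ a ∣ < n → - (+ n) ℤ.< a
∣i∣<n⇒-n<i {suc n} (+ _)    _         = ℤ.-<+
∣i∣<n⇒-n<i {suc n} -[1+ _ ] (s≤s a≤n) = ℤ.-<- a≤n

∣i∣<n⇒∣-i∣<n : ∀ {n} a → ∣ a ∣ < n → ∣ - a ∣ < n
∣i∣<n⇒∣-i∣<n {n} a a<n = subst (_< n) (sym (ℤ.∣-i∣≡∣i∣ a)) a<n

altdesFrom-insert : ∀ p a s y σ → altdesFrom p a (s ∷ map -_ (y ∷ σ))
  ≡ localDescent p a s + localDescent (flip p) s (- y) + altdesFrom (flip p) y σ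
altdesFrom-insert even a s y σ =
  trans (cong (λ t → localDescent even a s + (localDescent odd s (- y) + t)) (altdesFrom-neg even y σ))
        (sym (ℕ.+-assoc (localDescent even a s) _ _))
altdesFrom-insert odd a s y σ =
  trans (cong (λ t → localDescent odd a s + (localDescent even s (- y) + t)) (altdesFrom-neg odd y σ))
        (sym (ℕ.+-assoc (localDescent odd a s) _ _))

occurrences-top-bottom : ∀ {N} p a y σ → ∣ a ∣ < N → ∣ y ∣ < N → ∀ m →
  let A = altdesFrom (flip p) y σ in
  δ m (altdesFrom p a (+ N ∷ map -_ (y ∷ σ))) + δ m (altdesFrom p a (- + N ∷ map -_ (y ∷ σ)))
  ≡ δ m A + δ m (2 + A)
occurrences-top-bottom {N} even a y σ a<N y<N m
  rewrite altdesFrom-insert even a (+ N) y σ | altdesFrom-insert even a (- + N) y σ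
        | indicator-yes (a ℤ.<? + N) (∣i∣<n⇒i<+n a a<N)
        | indicator-yes (- y ℤ.<? + N) (∣i∣<n⇒i<+n (- y) (∣i∣<n⇒∣-i∣<n y y<N))
        | indicator-no (a ℤ.<? - + N) (ℤ.<-asym (∣i∣<n⇒-n<i a a<N))
        | indicator-no (- y ℤ.<? - + N) (ℤ.<-asym (∣i∣<n⇒-n<i (- y) (∣i∣<n⇒∣-i∣<n y y<N))) =
  ℕ.+-comm (δ m (2 + altdesFrom odd y σ)) _
occurrences-top-bottom {N} odd a y σ a<N y<N m
  rewrite altdesFrom-insert odd a (+ N) y σ | altdesFrom-insert odd a (- + N) y σ
        | indicator-no (+ N ℤ.<? a) (ℤ.<-asym (∣i∣<n⇒i<+n a a<N))
        | indicator-no (+ N ℤ.<? - y) (ℤ.<-asym (∣i∣<n⇒i<+n (- y) (∣i∣<n⇒∣-i∣<n y y<N)))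
        | indicator-yes (- + N ℤ.<? a) (∣i∣<n⇒-n<i a a<N)
        | indicator-yes (- + N ℤ.<? - y) (∣i∣<n⇒-n<i (- y) (∣i∣<n⇒∣-i∣<n y y<N)) =
  refl

occurrences-insertions : ∀ {N} p a σ → ∣ a ∣ < N → All (λ y → ∣ y ∣ < N) σ → ∀ m →
  occurrences m (map (altdesFrom p a) (insertions (+ N) σ))
    ≡ insertionCount (altdesFrom p a σ) (length σ) m
occurrences-insertions {N} even a [] a<N [] m
  rewrite indicator-yes (a ℤ.<? + N) (∣i∣<n⇒i<+n a a<N)
        | indicator-no (a ℤ.<? - + N) (ℤ.<-asym (∣i∣<n⇒-n<i a a<N)) =
  identity (δ (suc m) 0) (δ m 0) (δ m 1) (δ m 2)
  where
  identity : ∀ u w v z → v + (w + 0) ≡ 0 * u + 1 * w + 1 * v + 0 * z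
  identity = solve-∀
occurrences-insertions {N} odd a [] a<N [] m
  rewrite indicator-no (+ N ℤ.<? a) (ℤ.<-asym (∣i∣<n⇒i<+n a a<N))
        | indicator-yes (- + N ℤ.<? a) (∣i∣<n⇒-n<i a a<N) =
  identity (δ (suc m) 0) (δ m 0) (δ m 1) (δ m 2)
  where
  identity : ∀ u w v z → w + (v + 0) ≡ 0 * u + 1 * w + 1 * v + 0 * z
  identity = solve-∀
occurrences-insertions {N} p a (y ∷ σ) a<N (y<N ∷ σ<N) m = begin
  δ m (altdesFrom p a w⁺) + (δ m (altdesFrom p a w⁻) + rest)
    ≡⟨ sym (ℕ.+-assoc (δ m (altdesFrom p a w⁺)) _ _) ⟩
  δ m (altdesFrom p a w⁺) + δ m (altdesFrom p a w⁻) + rest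
    ≡⟨ cong₂ _+_ (occurrences-top-bottom p a y σ a<N y<N m) (cong (occurrences m) after-head) ⟩
  δ m A + δ m (2 + A) + occurrences m (map (_+_ s) (map (altdesFrom (flip p) y) I))
    ≡⟨ insertionCount-∷ m (map (altdesFrom (flip p) y) I) (indicator-≤1 (descent? p a y))
                        (altdesFrom-≤-length (flip p) y σ) (occurrences-insertions (flip p) y σ y<N σ<N) ⟩
  insertionCount (s + A) (suc (length σ)) m
    ≡⟨ cong (λ B → insertionCount B (suc (length σ)) m) (sym (altdesFrom-∷ p a y σ)) ⟩
  insertionCount (altdesFrom p a (y ∷ σ)) (suc (length σ)) m ∎
  where
  open ≡-Reasoning
  w⁺ w⁻ : List ℤ
  w⁺ = + N ∷ map -_ (y ∷ σ)
  w⁻ = - + N ∷ map -_ (y ∷ σ)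
  I : List (List ℤ)
  I = insertions (+ N) σ
  s A rest : ℕ
  rest = occurrences m (map (altdesFrom p a) (map (y ∷_) I))
  s = localDescent p a y
  A = altdesFrom (flip p) y σ
  after-head : map (altdesFrom p a) (map (y ∷_) I) ≡ map (_+_ s) (map (altdesFrom (flip p) y) I)
  after-head = trans (sym (List.map-∘ I)) (trans (List.map-cong (altdesFrom-∷ p a y) I) (List.map-∘ I))

prev : (ℕ → ℕ) → ℕ → ℕ
prev b zero    = 0
prev b (suc j) = b j

nextRow : ℕ → (ℕ → ℕ) → ℕ → ℕ
nextRow n b m = suc m * b (suc m) + (suc n ∸ m) * b m + m * prev b m + (suc (suc n) ∸ m) * prev (prev b) m

prev-cong : ∀ {b c} → (∀ j → b j ≡ c j) → ∀ m → prev b m ≡ prev c m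
prev-cong b≗c zero    = refl
prev-cong b≗c (suc m) = b≗c m

nextRow-cong : ∀ n {b c} → (∀ j → b j ≡ c j) → ∀ m → nextRow n b m ≡ nextRow n c m
nextRow-cong n {b} b≗c m =
  cong₂ _+_ (cong₂ _+_ (cong₂ _+_ (cong (suc m *_) (b≗c (suc m))) (cong ((suc n ∸ m) *_) (b≗c m)))
                       (cong (m *_) (prev-cong b≗c m)))
            (cong ((suc (suc n) ∸ m) *_) (prev-cong (prev-cong b≗c) m))

prev-+ : ∀ b c m → prev (λ j → b j + c j) m ≡ prev b m + prev c m
prev-+ b c zero    = refl
prev-+ b c (suc m) = refl

prev²-+ : ∀ b c m → prev (prev (λ j → b j + c j)) m ≡ prev (prev b) m + prev (prev c) m
prev²-+ b c zero    = refl
prev²-+ b c (suc m) = prev-+ b c m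

nextRow-+ : ∀ n b c m → nextRow n (λ j → b j + c j) m ≡ nextRow n b m + nextRow n c m
nextRow-+ n b c m rewrite prev-+ b c m | prev²-+ b c m =
  linear (suc m) (suc n ∸ m) m (suc (suc n) ∸ m)
         (b (suc m)) (b m) (prev b m) (prev (prev b) m) (c (suc m)) (c m) (prev c m) (prev (prev c) m)
  where
  linear : ∀ α β γ ε x y z w x′ y′ z′ w′ →
    α * (x + x′) + β * (y + y′) + γ * (z + z′) + ε * (w + w′)
    ≡ (α * x + β * y + γ * z + ε * w) + (α * x′ + β * y′ + γ * z′ + ε * w′)
  linear = solve-∀

prev-zero : ∀ m → prev (λ _ → 0) m ≡ 0
prev-zero zero    = refl
prev-zero (suc m) = refl

prev²-zero : ∀ m → prev (prev (λ _ → 0)) m ≡ 0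
prev²-zero zero    = refl
prev²-zero (suc m) = prev-zero m

nextRow-zero : ∀ n m → nextRow n (λ _ → 0) m ≡ 0
nextRow-zero n m rewrite prev-zero m | prev²-zero m =
  annihilate (suc m) (suc n ∸ m) m (suc (suc n) ∸ m)
  where
  annihilate : ∀ α β γ ε → α * 0 + β * 0 + γ * 0 + ε * 0 ≡ 0
  annihilate = solve-∀

sum-nextRow-δ : ∀ n m ks →
  sum (map (λ k → nextRow n (λ j → δ j k) m) ks) ≡ nextRow n (λ j → occurrences j ks) m
sum-nextRow-δ n m []       = sym (nextRow-zero n m)
sum-nextRow-δ n m (k ∷ ks) =
  trans (cong (_+_ (nextRow n (λ j → δ j k) m)) (sum-nextRow-δ n m ks))
        (sym (nextRow-+ n (λ j → δ j k) (λ j → occurrences j ks) m))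

prev-δ : ∀ A m → prev (λ j → δ j A) m ≡ δ m (suc A)
prev-δ A zero    = refl
prev-δ A (suc m) = refl

prev²-δ : ∀ A m → prev (prev (λ j → δ j A)) m ≡ δ m (suc (suc A))
prev²-δ A zero    = refl
prev²-δ A (suc m) = prev-δ A m

insertionCount≡nextRow : ∀ {A L} m → A ≤ L → insertionCount A L m ≡ nextRow L (λ j → δ j A) m
insertionCount≡nextRow {A} {L} m A≤L =
  cong₂ _+_ (cong₂ _+_ (cong₂ _+_ descent-lost descent-kept) descent-gained) two-gained
  where
  descent-lost : A * δ (suc m) A ≡ suc m * δ (suc m) A
  descent-lost = δ-scale (suc m) A sym
  descent-kept : suc (L ∸ A) * δ m A ≡ (suc L ∸ m) * δ m A
  descent-kept = δ-scale m A {suc (L ∸ A)} {suc L ∸ m} (λ { refl → sym (ℕ.+-∸-assoc 1 A≤L) })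
  descent-gained : suc A * δ m (suc A) ≡ m * prev (λ j → δ j A) m
  descent-gained = trans (δ-scale m (suc A) sym) (cong (m *_) (sym (prev-δ A m)))
  two-gained : (L ∸ A) * δ m (suc (suc A)) ≡ (suc (suc L) ∸ m) * prev (prev (λ j → δ j A)) m
  two-gained = trans (δ-scale m (suc (suc A)) {L ∸ A} {suc (suc L) ∸ m} λ { refl → refl })
                     (cong ((suc (suc L) ∸ m) *_) (sym (prev²-δ A m)))

occurrences-concatMap : ∀ {A : Set} m (f : A → List ℕ) xs →
  occurrences m (concatMap f xs) ≡ sum (map (occurrences m ∘ f) xs)
occurrences-concatMap m f []       = refl
occurrences-concatMap m f (x ∷ xs) = begin
  sum (map (δ m) (f x ++ concatMap f xs))
    ≡⟨ cong sum (List.map-++ (δ m) (f x) _) ⟩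
  sum (map (δ m) (f x) ++ map (δ m) (concatMap f xs))
    ≡⟨ Sum.sum-++ (map (δ m) (f x)) _ ⟩
  occurrences m (f x) + occurrences m (concatMap f xs)
    ≡⟨ cong (_+_ (occurrences m (f x))) (occurrences-concatMap m f xs) ⟩
  occurrences m (f x) + sum (map (occurrences m ∘ f) xs) ∎
  where open ≡-Reasoning

Bhat-recurrence : ∀ n m → Bhat (suc n) m ≡ nextRow n (Bhat n) m
Bhat-recurrence n m = begin
  Bhat (suc n) m
    ≡⟨ Bhat-occurrences (suc n) m ⟩
  occurrences m (map altdesB (signedPerms (suc n)))
    ≡⟨ occurrences-↭ m (↭.map⁺ altdesB (signedPerms-suc-↭ n)) ⟩
  occurrences m (map altdesB (concatMap (insertions (+ suc n)) SP))
    ≡⟨ cong (occurrences m) (List.map-concatMap altdesB (insertions (+ suc n)) SP) ⟩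
  occurrences m (concatMap (map altdesB ∘ insertions (+ suc n)) SP)
    ≡⟨ occurrences-concatMap m _ SP ⟩
  sum (map (λ σ → occurrences m (map altdesB (insertions (+ suc n) σ))) SP)
    ≡⟨ cong sum (List.map-cong-local (All.tabulate (per-perm ∘ ∈-signedPerms⁻ n))) ⟩
  sum (map (λ σ → nextRow n (λ j → δ j (altdesB σ)) m) SP)
    ≡⟨ cong sum (List.map-∘ SP) ⟩
  sum (map (λ k → nextRow n (λ j → δ j k) m) (map altdesB SP))
    ≡⟨ sum-nextRow-δ n m (map altdesB SP) ⟩
  nextRow n (λ j → occurrences j (map altdesB SP)) m
    ≡⟨ nextRow-cong n (λ j → sym (Bhat-occurrences n j)) m ⟩
  nextRow n (Bhat n) m ∎
  where
  open ≡-Reasoning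
  SP : List (List ℤ)
  SP = signedPerms n
  per-perm : ∀ {σ} → SignedPerm n σ →
    occurrences m (map altdesB (insertions (+ suc n) σ)) ≡ nextRow n (λ j → δ j (altdesB σ)) m
  per-perm {σ} perm@(len , ranges , _) = begin
    occurrences m (map altdesB (insertions (+ suc n) σ))
      ≡⟨ occurrences-insertions even (+ 0) σ (s≤s z≤n) (All.map s≤s (All.map⁻ (All.map proj₂ ranges))) m ⟩
    insertionCount (altdesB σ) (length σ) m
      ≡⟨ cong (λ L → insertionCount (altdesB σ) L m) len ⟩
    insertionCount (altdesB σ) n m
      ≡⟨ insertionCount≡nextRow m (altdesB-≤ perm) ⟩
    nextRow n (λ j → δ j (altdesB σ)) m ∎

-- Unimodality

Palindromic : ℕ → (ℕ → ℕ) → Set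
Palindromic n b = ∀ k → k ≤ n → b k ≡ b (n ∸ k)

RisesToCentre : ℕ → (ℕ → ℕ) → Set
RisesToCentre n b = ∀ j → suc (suc (j + j)) ≤ n → b j ≤ b (suc j)

CentralBound : ℕ → (ℕ → ℕ) → Set
CentralBound m b = b m + (3 + m) * prev (prev b) m ≤ (4 + m) * prev b m

Palindromic-sym : ∀ {n b} → Palindromic n b → ∀ {j k} → j + k ≡ n → b j ≡ b k
Palindromic-sym {n} {b} pal {j} {k} refl =
  trans (pal j (ℕ.m≤m+n j k)) (cong b (ℕ.m+n∸m≡n j k))

rises-through-centre : ∀ {n b} → Palindromic n b → RisesToCentre n b →
  ∀ j → suc (j + j) ≤ n → b j ≤ b (suc j)
rises-through-centre pal rises j 2j+1≤n with ℕ.m≤n⇒m<n∨m≡n 2j+1≤n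
... | inj₁ 2j+1<n = rises j 2j+1<n
... | inj₂ 2j+1≡n = ℕ.≤-reflexive (Palindromic-sym pal (trans (ℕ.+-suc j j) 2j+1≡n))

prev-≤ : ∀ b i → (∀ j → suc j ≤ i → b j ≤ b (suc j)) → prev b i ≤ b i
prev-≤ b zero    _     = z≤n
prev-≤ b (suc i) rises = rises i ℕ.≤-refl

prev²-≤ : ∀ b i → (∀ j → suc j ≤ i → b j ≤ b (suc j)) → prev (prev b) i ≤ prev b i
prev²-≤ b zero    _     = z≤n
prev²-≤ b (suc i) rises = prev-≤ b i (λ j j<i → rises j (ℕ.m≤n⇒m≤1+n j<i))

nextRowFormula : ℕ → ℕ → ℕ → ℕ → ℕ → ℕ → ℕ
nextRowFormula m k w x y z = suc m * z + suc k * y + m * x + suc (suc k) * w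

nextRow-at : ∀ {n} m k b → m + k ≡ n →
  nextRow n b m ≡ nextRowFormula m k (prev (prev b) m) (prev b m) (b m) (b (suc m))
nextRow-at m k b refl = cong₂ (λ α β → suc m * b (suc m) + α * b m + m * prev b m + β * prev (prev b) m)
  (cancel 1) (cancel 2)
  where
  cancel : ∀ c → c + (m + k) ∸ m ≡ c + k
  cancel c = trans (ℕ.+-∸-assoc c (ℕ.m≤m+n m k)) (cong (_+_ c) (ℕ.m+n∸m≡n m k))

nextRow-rises-at : ∀ {n} i k b → i + suc k ≡ n →
  nextRowFormula i (suc k) (prev (prev b) i) (prev b i) (b i) (b (suc i))
    ≤ nextRowFormula (suc i) k (prev b i) (b i) (b (suc i)) (b (suc (suc i))) →
  nextRow n b i ≤ nextRow n b (suc i)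
nextRow-rises-at i k b eq =
  subst₂ _≤_ (sym (nextRow-at i (suc k) b eq))
             (sym (nextRow-at (suc i) k b (trans (sym (ℕ.+-suc i k)) eq)))

formula-rises : ∀ m k {w x y z v} → w ≤ x → x ≤ y → y ≤ z → z ≤ v →
  nextRowFormula m (suc k) w x y z ≤ nextRowFormula (suc m) k x y z v
formula-rises m k {w} w≤x x≤y y≤z z≤v
  with ℕ.m≤n⇒∃[o]m+o≡n w≤x | ℕ.m≤n⇒∃[o]m+o≡n x≤y
     | ℕ.m≤n⇒∃[o]m+o≡n y≤z | ℕ.m≤n⇒∃[o]m+o≡n z≤v
... | a , refl | b , refl | c , refl | d , refl =
  ℕ.m+n≤o⇒m≤o _ (ℕ.≤-reflexive (identity m k w a b c d))
  where
  identity : ∀ m k w a b c d →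
    suc m * (w + a + b + c) + suc (suc k) * (w + a + b) + m * (w + a) + suc (suc (suc k)) * w
      + (suc (suc (suc k)) * a + suc m * b + suc (suc k) * c + suc (suc m) * d)
    ≡ suc (suc m) * (w + a + b + c + d) + suc k * (w + a + b + c) + suc m * (w + a + b) + suc (suc k) * (w + a)
  identity = solve-∀

formula-rises-folded : ∀ m {w x y z v} → w ≤ x → x ≤ y → y ≤ z → v ≡ y →
  nextRowFormula m (suc (suc m)) w x y z ≤ nextRowFormula (suc m) (suc m) x y z v
formula-rises-folded m {w} w≤x x≤y y≤z refl
  with ℕ.m≤n⇒∃[o]m+o≡n w≤x | ℕ.m≤n⇒∃[o]m+o≡n x≤y | ℕ.m≤n⇒∃[o]m+o≡n y≤z
... | a , refl | b , refl | c , refl =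
  ℕ.m+n≤o⇒m≤o _ (ℕ.≤-reflexive (identity m w a b c))
  where
  identity : ∀ m w a b c →
    suc m * (w + a + b + c) + (3 + m) * (w + a + b) + m * (w + a) + (4 + m) * w
      + ((4 + m) * a + suc m * b + c)
    ≡ (2 + m) * (w + a + b) + (2 + m) * (w + a + b + c) + suc m * (w + a + b) + (3 + m) * (w + a)
  identity = solve-∀

formula-rises-centre : ∀ m {w x y z v} → z ≡ y → v ≡ x → y + (3 + m) * w ≤ (4 + m) * x →
  nextRowFormula m (suc m) w x y z ≤ nextRowFormula (suc m) m x y z v
formula-rises-centre m {w} {x} {y} refl refl bound = ℕ.+-cancelʳ-≤ ((4 + m) * x) _ _ (begin
  nextRowFormula m (suc m) w x y y + (4 + m) * x       ≡⟨ identity m w x y ⟩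
  nextRowFormula (suc m) m x y y x + (y + (3 + m) * w)  ≤⟨ ℕ.+-monoʳ-≤ (nextRowFormula (suc m) m x y y x) bound ⟩
  nextRowFormula (suc m) m x y y x + (4 + m) * x        ∎)
  where
  open ℕ.≤-Reasoning
  identity : ∀ m w x y → suc m * y + (2 + m) * y + m * x + (3 + m) * w + (4 + m) * x
                         ≡ (2 + m) * x + suc m * y + suc m * y + (2 + m) * x + (y + (3 + m) * w)
  identity = solve-∀

window-rises : ∀ {n b} → Palindromic n b → RisesToCentre n b → ∀ i → suc (i + i) ≤ n →
  prev (prev b) i ≤ prev b i × prev b i ≤ b i × b i ≤ b (suc i)
window-rises {b = b} pal rises i 2i+1≤n =
  prev²-≤ b i (λ j → below j ∘ ℕ.m≤n⇒m≤1+n) ,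
  prev-≤ b i (λ j → below j ∘ ℕ.m≤n⇒m≤1+n) ,
  below i ℕ.≤-refl
  where
  below : ∀ j → suc j ≤ suc i → b j ≤ b (suc j)
  below j (s≤s j≤i) = rises-through-centre pal rises j (ℕ.≤-trans (s≤s (ℕ.+-mono-≤ j≤i j≤i)) 2i+1≤n)

nextRow-rises-inside : ∀ {n b} i r → suc (i + i) + suc (suc r) ≡ n →
  Palindromic n b → RisesToCentre n b → nextRow n b i ≤ nextRow n b (suc i)
nextRow-rises-inside {n} {b} i r refl pal rises with window-rises pal rises i (ℕ.m≤m+n _ _)
... | w≤x , x≤y , y≤z = nextRow-rises-at i (i + suc (suc r)) b (shape i r)
  (formula-rises i (i + suc (suc r)) w≤x x≤y y≤z
    (rises-through-centre pal rises (suc i) (ℕ.m+n≤o⇒m≤o _ (ℕ.≤-reflexive (next-shape i r)))))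
  where
  shape : ∀ i r → i + suc (i + suc (suc r)) ≡ suc (i + i) + suc (suc r)
  shape = solve-∀
  next-shape : ∀ i r → suc (suc i + suc i) + r ≡ suc (i + i) + suc (suc r)
  next-shape = solve-∀

nextRow-rises-folded : ∀ {n b} i → suc (i + i) + 1 ≡ n → Palindromic n b → RisesToCentre n b →
  nextRow n b i ≤ nextRow n b (suc i)
nextRow-rises-folded {n} {b} i refl pal rises with window-rises pal rises i (ℕ.m≤m+n _ _)
... | w≤x , x≤y , y≤z = nextRow-rises-at i (suc i) b (shape i)
  (formula-rises-folded i w≤x x≤y y≤z (Palindromic-sym pal (mirror i)))
  where
  shape : ∀ i → i + suc (suc i) ≡ suc (i + i) + 1
  shape = solve-∀
  mirror : ∀ i → suc (suc i) + i ≡ suc (i + i) + 1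
  mirror = solve-∀

nextRow-rises-centre : ∀ {n b} i → suc (suc i + suc i) ≡ n →
  Palindromic n b → CentralBound (suc i) b → nextRow n b (suc i) ≤ nextRow n b (suc (suc i))
nextRow-rises-centre {n} {b} i refl pal bound = nextRow-rises-at (suc i) (suc i) b (shape i)
  (formula-rises-centre (suc i) {prev b i} (Palindromic-sym pal (mirror₁ i)) (Palindromic-sym pal (mirror₂ i))
                        bound)
  where
  shape : ∀ i → suc i + suc (suc i) ≡ suc (suc i + suc i)
  shape = solve-∀
  mirror₁ : ∀ i → suc (suc i) + suc i ≡ suc (suc i + suc i)
  mirror₁ = solve-∀
  mirror₂ : ∀ i → suc (suc (suc i)) + i ≡ suc (suc i + suc i)
  mirror₂ = solve-∀

nextRow-rises : ∀ {n b} → 3 ≤ n → Palindromic n b → RisesToCentre n b →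
  (∀ m → suc (m + m) ≡ n → CentralBound m b) → RisesToCentre (suc n) (nextRow n b)
nextRow-rises 3≤n pal rises central i 2i+2≤1+n with ℕ.m≤n⇒∃[o]m+o≡n (ℕ.≤-pred 2i+2≤1+n)
nextRow-rises 3≤n pal rises central zero    _ | zero , eq =
  ⊥-elim (3≰1 (subst (3 ≤_) (sym eq) 3≤n))
  where
  3≰1 : ¬ 3 ≤ 1
  3≰1 (s≤s ())
nextRow-rises 3≤n pal rises central (suc i) _ | zero , eq =
  nextRow-rises-centre i eq′ pal (central (suc i) eq′)
  where
  eq′ : suc (suc i + suc i) ≡ _
  eq′ = trans (sym (ℕ.+-identityʳ _)) eq
nextRow-rises 3≤n pal rises central i _ | suc zero    , eq = nextRow-rises-folded i eq pal rises
nextRow-rises 3≤n pal rises central i _ | suc (suc r) , eq = nextRow-rises-inside i r eq pal rises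

formula-CentralBound : ∀ t {w x y z v u} → w ≤ x → x ≤ y → y ≤ z → z ≤ v → u ≡ z →
  nextRowFormula (2 + t) (2 + t) y z v u + (5 + t) * nextRowFormula t (4 + t) w x y z
    ≤ (6 + t) * nextRowFormula (1 + t) (3 + t) x y z v
formula-CentralBound t {w} w≤x x≤y y≤z z≤v refl
  with ℕ.m≤n⇒∃[o]m+o≡n w≤x | ℕ.m≤n⇒∃[o]m+o≡n x≤y
     | ℕ.m≤n⇒∃[o]m+o≡n y≤z | ℕ.m≤n⇒∃[o]m+o≡n z≤v
... | a , refl | b , refl | c , refl | d , refl =
  ℕ.m+n≤o⇒m≤o _ (ℕ.≤-reflexive (identity t w a b c d))
  where
  identity : ∀ t w a b c d →
    (3 + t) * (w + a + b + c) + (3 + t) * (w + a + b + c + d) + (2 + t) * (w + a + b + c)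
      + (4 + t) * (w + a + b)
      + (5 + t) * ((1 + t) * (w + a + b + c) + (5 + t) * (w + a + b) + t * (w + a) + (6 + t) * w)
      + ((t * t + 7 * t + 9) * d + (t * t + 9 * t + 23) * c + (t + 5) * t * b + (t + 5) * (t + 6) * a)
    ≡ (6 + t) * ((2 + t) * (w + a + b + c + d) + (4 + t) * (w + a + b + c) + (1 + t) * (w + a + b)
                 + (5 + t) * (w + a))
  identity = solve-∀

nextRow-CentralBound : ∀ {n b} m → m + m ≡ n → 3 ≤ n → Palindromic n b → RisesToCentre n b →
  CentralBound m (nextRow n b)
nextRow-CentralBound zero       refl ()
nextRow-CentralBound (suc zero) refl (s≤s (s≤s ()))
nextRow-CentralBound {n} {b} (suc (suc t)) eq _ pal rises =
  let w≤x , x≤y , y≤z = window-rises pal rises t (ℕ.m+n≤o⇒m≤o _ (ℕ.≤-reflexive (trans (centre t) eq))) in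
  subst₂ _≤_ (sym (cong₂ (λ p q → p + (5 + t) * q) (nextRow-at (2 + t) (2 + t) b eq)
                                                   (nextRow-at t (4 + t) b (trans (shape₀ t) eq))))
             (sym (cong ((6 + t) *_) (nextRow-at (1 + t) (3 + t) b (trans (shape₁ t) eq))))
             (formula-CentralBound t w≤x x≤y y≤z
               (rises (suc t) (ℕ.≤-reflexive (trans (shape₂ t) eq)))
               (Palindromic-sym pal (trans (mirror t) eq)))
  where
  centre : ∀ t → suc (t + t) + 3 ≡ suc (suc t) + suc (suc t)
  centre = solve-∀
  shape₀ : ∀ t → t + (4 + t) ≡ suc (suc t) + suc (suc t)
  shape₀ = solve-∀
  shape₁ : ∀ t → suc t + (3 + t) ≡ suc (suc t) + suc (suc t)
  shape₁ = solve-∀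
  shape₂ : ∀ t → suc (suc (suc t + suc t)) ≡ suc (suc t) + suc (suc t)
  shape₂ = solve-∀
  mirror : ∀ t → (3 + t) + suc t ≡ suc (suc t) + suc (suc t)
  mirror = solve-∀

RisesToCentre-cong : ∀ {n b c} → (∀ j → b j ≡ c j) → RisesToCentre n b → RisesToCentre n c
RisesToCentre-cong b≗c rises j h = subst₂ _≤_ (b≗c j) (b≗c (suc j)) (rises j h)

CentralBound-cong : ∀ {m b c} → (∀ j → b j ≡ c j) → CentralBound m b → CentralBound m c
CentralBound-cong {m} b≗c =
  subst₂ _≤_ (cong₂ (λ p q → p + (3 + m) * q) (b≗c m) (prev-cong (prev-cong b≗c) m))
             (cong ((4 + m) *_) (prev-cong b≗c m))

UnimodalInvariant : ℕ → (ℕ → ℕ) → Set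
UnimodalInvariant n b = RisesToCentre n b × (∀ m → suc (m + m) ≡ n → CentralBound m b)

Bhat-invariant : ∀ j → UnimodalInvariant (3 + j) (Bhat (3 + j))
Bhat-invariant zero    = rises₃ , central₃
  where
  rises₃ : RisesToCentre 3 (Bhat 3)
  rises₃ zero    _                     = toWitness {a? = Bhat 3 0 ≤? Bhat 3 1} _
  rises₃ (suc j) (s≤s (s≤s (s≤s h))) = ⊥-elim (ℕ.m+1+n≢0 j (ℕ.n≤0⇒n≡0 h))
  central₃ : ∀ m → suc (m + m) ≡ 3 → CentralBound m (Bhat 3)
  central₃ (suc zero)    _  = toWitness {a? = Bhat 3 1 + 4 * 0 ≤? 5 * Bhat 3 0} _
  central₃ (suc (suc m)) eq =
    ⊥-elim (ℕ.m+1+n≢0 m (ℕ.suc-injective (ℕ.suc-injective (ℕ.suc-injective eq))))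
Bhat-invariant (suc j) =
  let rises , central = Bhat-invariant j in
  RisesToCentre-cong recurrence (nextRow-rises 3≤n pal rises central) ,
  λ m eq → CentralBound-cong recurrence (nextRow-CentralBound m (ℕ.suc-injective eq) 3≤n pal rises)
  where
  n : ℕ
  n = 3 + j
  3≤n : 3 ≤ n
  3≤n = ℕ.m≤m+n 3 j
  pal : Palindromic n (Bhat n)
  pal = Bhat-palindromic n
  recurrence : ∀ i → nextRow n (Bhat n) i ≡ Bhat (suc n) i
  recurrence i = sym (Bhat-recurrence n i)

∃-half : ∀ n → ∃[ m ] (m + m ≤ n × n ≤ suc (m + m))
∃-half zero          = 0 , z≤n , z≤n
∃-half (suc zero)    = 0 , z≤n , ℕ.≤-refl
∃-half (suc (suc n)) with ∃-half n
... | m , 2m≤n , n≤2m+1 = suc m , subst (_≤ 2 + n) (sym 2[1+m]) (s≤s (s≤s 2m≤n))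
                                , subst (2 + n ≤_) (cong suc (sym 2[1+m])) (s≤s (s≤s n≤2m+1))
  where
  2[1+m] : suc m + suc m ≡ 2 + (m + m)
  2[1+m] = cong suc (ℕ.+-suc m m)

unimodal : ∀ {n b} → Palindromic n b → RisesToCentre n b → Unimodal b n
unimodal {n} {b} pal rises with ∃-half n
... | m , 2m≤n , n≤2m+1 = m , ℕ.≤-trans (ℕ.m≤m+n m m) 2m≤n , up , down
  where
  up : ∀ i → suc i ≤ m → b i ≤ b (suc i)
  up i i<m = rises i (ℕ.≤-trans (ℕ.≤-reflexive (cong suc (sym (ℕ.+-suc i i))))
                                (ℕ.≤-trans (ℕ.+-mono-≤ i<m i<m) 2m≤n))
  down : ∀ i → m ≤ i → suc i ≤ n → b (suc i) ≤ b i
  down i m≤i i<n with ℕ.m≤n⇒∃[o]m+o≡n i<n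
  ... | e , eq = subst₂ _≤_ (sym (Palindromic-sym pal eq))
                            (sym (Palindromic-sym pal (trans (ℕ.+-suc i e) eq)))
                            (rises-through-centre pal rises e 2e+1≤n)
    where
    e≤m : e ≤ m
    e≤m = ℕ.+-cancelˡ-≤ i e m
            (ℕ.≤-trans (ℕ.≤-pred (subst (_≤ suc (m + m)) (sym eq) n≤2m+1)) (ℕ.+-monoˡ-≤ m m≤i))
    2e+1≤n : suc (e + e) ≤ n
    2e+1≤n = subst (suc (e + e) ≤_) eq (s≤s (ℕ.+-monoˡ-≤ e (ℕ.≤-trans e≤m m≤i)))

mainTheorem4 : ∀ n → 3 ≤ n →
    (∀ k → k ≤ n → Bhat n k ≡ Bhat n (n ∸ k)) × Unimodal (Bhat n) n
mainTheorem4 n 3≤n with ℕ.m≤n⇒∃[o]m+o≡n 3≤n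
... | j , refl = Bhat-palindromic (3 + j) , unimodal (Bhat-palindromic (3 + j)) (proj₁ (Bhat-invariant j))
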